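{- Let $\mathcal{T}$ be a tanglegram, $X\subseteq\sigma_{\mathcal{T}}$, $m_1\in X$ and $m_2\in\sigma_{\mathcal{T}}\setminus X$. Suppose $m_1$ joins the leaf $\lambda_1$ of $L_{\mathcal{T}}$ to the leaf $\lambda_2$ of $R_{\mathcal{T}}$. Let $G$ be the set of the three edges of the left tree of $\mathcal{T}[X]$ incident to the parent of $\lambda_1$ in that tree, and $H$ the set of the three edges of the right tree of $\mathcal{T}[X]$ incident to the parent of $\lambda_2$ in that tree. If the scar-type of $m_2$ on $\mathcal{T}[X]$ lies in $G\times H$, then $\mathcal{T}[(X\setminus\{m_1\})\cup\{m_2\}]$ is isomorphic to $\mathcal{T}[X]$.
   Context: A rooted tree is a tree with at least two vertices and a designated root vertex of degree $1$; leaves are non-root vertices of degree $1$; a rooted binary tree is a rooted tree whose non-leaf, non-root vertices all have degree $3$. The parent of $y$ is its neighbor on the root-to-$y$ path. For a set $S$ of leaves of a rooted binary tree $T$, $T\llbracket S\rrbracket$ is the union of the root-to-$s$ paths for $s\in S$ and $T[S]$ is obtained from it by suppressing degree-$2$ vertices; each edge $e$ of $T[S]$ corresponds to a path $P_e$ in $T\llbracket S\rrbracket$. For a leaf $w\notin S$, the scar of $w$ in $T[S]$ is on edge $e$ if the first vertex of $T\llbracket S\rrbracket$ met by the path from $w$ to the root is an interior vertex of $P_e$. A tanglegram $\mathcal{T}=(L_{\mathcal{T}},R_{\mathcal{T}},\sigma_{\mathcal{T}})$ consists of two rooted binary trees with equally many leaves and a perfect matching $\sigma_{\mathcal{T}}$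 between their leaf sets. For $Z\subseteq\sigma_{\mathcal{T}}$ the induced subtanglegram $\mathcal{T}[Z]$ has left tree $L_{\mathcal{T}}[S_1]$, right tree $R_{\mathcal{T}}[S_2]$ and matching $Z$, where $S_1,S_2$ are the left and right leaves covered by $Z$. Tanglegrams are isomorphic if there is a graph isomorphism mapping left root to left root and right root to right root. For $m\in\sigma_{\mathcal{T}}\setminus Z$ joining left leaf $\mu_1$ and right leaf $\mu_2$, its left-scar in $\mathcal{T}[Z]$ is the scar of $\mu_1$ in $L_{\mathcal{T}}[S_1]$ and its right-scar is the scar of $\mu_2$ in $R_{\mathcal{T}}[S_2]$; the scar-type of $m$ on $\mathcal{T}[Z]$ is the ordered pair $(e,f)$ where the left-scar is on edge $e$ of $L_{\mathcal{T}}[S_1]$ and the right-scar is on edge $f$ of $R_{\mathcal{T}}[S_2]$. -}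

module Defs where

open import Data.Nat using (ℕ)
open import Data.Fin using (Fin)
open import Data.Bool using (Bool; true; false; if_then_else_)
open import Data.Vec using (lookup)
open import Data.Fin.Subset using (Subset; _∈_; _∉_; _-_; _∪_; ⁅_⁆)
open import Data.List using (List; []; _∷_; _++_; allFin)
open import Data.List.Relation.Unary.Any using (Any)
open import Data.List.Relation.Binary.Permutation.Propositional using (_↭_)
open import Data.Maybe using (Maybe; just; nothing)
open import Data.Product using (Σ; Σ-syntax; _×_; ∃; ∃-syntax)
open import Data.Sum using (_⊎_)
open import Relation.Nullary using (¬_)
open import Relation.Binary.PropositionalEquality using (_≡_)

-- The (degree-1) root is implicit: a value  t : Tree A  denotes the rooted
-- binary tree whose root has a single child, the top vertex of t.
--   leaf a     : the top vertex is a leaf labelled a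
--   node l r   : the top vertex has degree 3 (parent + children l, r)
-- The order of the two children carries no meaning (see Iso below).

data Tree (A : Set) : Set where
  leaf : A → Tree A
  node : Tree A → Tree A → Tree A

leaves : ∀ {A} → Tree A → List A
leaves (leaf a)   = a ∷ []
leaves (node l r) = leaves l ++ leaves r

data Iso {A B : Set} (φ : A → B) : Tree A → Tree B → Set where
  leaf     : ∀ a → Iso φ (leaf a) (leaf (φ a))
  straight : ∀ {l r l′ r′} → Iso φ l l′ → Iso φ r r′ → Iso φ (node l r) (node l′ r′)
  cross    : ∀ {l r l′ r′} → Iso φ l r′ → Iso φ r l′ → Iso φ (node l r) (node l′ r′)

-- isomorphism of (defined) trees; "nothing" is never isomorphic to anything
data MIso {A B : Set} (φ : A → B) : Maybe (Tree A) → Maybe (Tree B) → Set where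
  just : ∀ {t u} → Iso φ t u → MIso φ (just t) (just u)

-- Tanglegrams with n matching edges.  The matching σ is Fin n; the
-- matching edge i joins the left leaf labelled i to the right leaf
-- labelled i.  Each label occurs exactly once in each tree.

record Tanglegram (n : ℕ) : Set where
  field
    L R      : Tree (Fin n)
    L-leaves : leaves L ↭ allFin n
    R-leaves : leaves R ↭ allFin n
open Tanglegram public

-- Induced subtree T[S]: union of root-to-s paths, then suppression of
-- degree-2 vertices.  Undefined (nothing) if no leaf is in S.

restrict : ∀ {n} → Subset n → Tree (Fin n) → Maybe (Tree (Fin n))
restrict S (leaf a) = if lookup S a then just (leaf a) else nothing
restrict S (node l r) with restrict S l | restrict S r
... | just l′  | just r′  = just (node l′ r′)
... | just l′  | nothing  = just l′
... | nothing  | just r′  = just r′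
... | nothing  | nothing  = nothing

-- Induced subtanglegram T[Z] (its two trees) and isomorphism of
-- induced subtanglegrams: a graph isomorphism fixing both roots maps the
-- left tree to the left tree, the right tree to the right tree, and
-- matching edges to matching edges; it is thus given by a relabelling
-- φ of matching edges inducing rooted isomorphisms of both trees.

IsoSub : ∀ {n} → Tanglegram n → Subset n → Subset n → Set
IsoSub T Z₁ Z₂ = Σ[ φ ∈ (Fin _ → Fin _) ]
  (MIso φ (restrict Z₁ (L T)) (restrict Z₂ (L T)) ×
   MIso φ (restrict Z₁ (R T)) (restrict Z₂ (R T)))

-- Vertices of a tree: Pos t is the set of non-root vertices of t
-- (here = the top vertex).  Each non-root vertex v has a unique edge
-- to its parent ("the edge above v").

data Pos {A : Set} : Tree A → Set where
  here : ∀ {t} → Pos t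
  goL  : ∀ {l r} → Pos l → Pos (node l r)
  goR  : ∀ {l r} → Pos r → Pos (node l r)

subtree : ∀ {A} (t : Tree A) → Pos t → Tree A
subtree t          here    = t
subtree (node l r) (goL p) = subtree l p
subtree (node l r) (goR p) = subtree r p

-- p ⊑ q : p lies on the path from q to the root (p is an ancestor of q
-- or q itself);  p ⊏ q : proper ancestor.
data _⊑_ {A : Set} : {t : Tree A} → Pos t → Pos t → Set where
  here⊑ : ∀ {t} {q : Pos t} → here ⊑ q
  goL⊑  : ∀ {l r} {p q : Pos l} → p ⊑ q → _⊑_ {t = node l r} (goL p) (goL q)
  goR⊑  : ∀ {l r} {p q : Pos r} → p ⊑ q → _⊑_ {t = node l r} (goR p) (goR q)

_⊏_ : ∀ {A} {t : Tree A} → Pos t → Pos t → Set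
p ⊏ q = p ⊑ q × ¬ (p ≡ q)

-- the subtree below v contains a leaf of S, i.e. v is a non-root vertex
-- of T⟦S⟧ (the root of T always belongs to T⟦S⟧)
InPaths : ∀ {n} → Subset n → (t : Tree (Fin n)) → Pos t → Set
InPaths S t v = Any (_∈ S) (leaves (subtree t v))

-- v is a non-root vertex of T[S]: a leaf in S, or a vertex of T⟦S⟧ of
-- degree 3 in T⟦S⟧ (both children below it contain leaves of S).
-- Edges of T[S] are identified with their lower endpoints: the edge e
-- with lower endpoint v (Kept) is the path P_e from v up to its parent
-- in T[S].
data Kept {n} (S : Subset n) (t : Tree (Fin n)) (v : Pos t) : Set where
  keptLeaf : ∀ {a} → subtree t v ≡ leaf a → a ∈ S → Kept S t v
  keptNode : ∀ {l r} → subtree t v ≡ node l r →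
             Any (_∈ S) (leaves l) → Any (_∈ S) (leaves r) → Kept S t v

-- vertices of T[S] (inside T): the root, or a kept non-root vertex
data Vtx {A : Set} (t : Tree A) : Set where
  root : Vtx t
  pos  : Pos t → Vtx t

data ParentIn {n} (S : Subset n) (t : Tree (Fin n)) (q : Pos t) : Vtx t → Set where
  parentRoot : (∀ u → u ⊏ q → ¬ Kept S t u) → ParentIn S t q root
  parentPos  : ∀ {p} → Kept S t p → p ⊏ q →
               (∀ u → p ⊏ u → u ⊏ q → ¬ Kept S t u) → ParentIn S t q (pos p)

-- v is an interior vertex of P_e, e the edge of T[S] with lower end q
Interior : ∀ {n} → Subset n → (t : Tree (Fin n)) → (q v : Pos t) → Set
Interior S t q v = v ⊏ q × (∀ u → v ⊑ u → u ⊏ q → ¬ Kept S t u)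

-- a is the first vertex of T⟦S⟧ met on the path from the leaf w to the root
Attach : ∀ {n} → Subset n → (t : Tree (Fin n)) → Fin n → Pos t → Set
Attach S t w a = Σ[ qw ∈ Pos _ ] (subtree t qw ≡ leaf w × a ⊑ qw × InPaths S t a ×
                 (∀ u → a ⊏ u → u ⊑ qw → ¬ InPaths S t u))

ScarOn : ∀ {n} → Subset n → (t : Tree (Fin n)) → Fin n → Pos t → Set
ScarOn S t w q = Kept S t q × Σ[ a ∈ Pos _ ] (Attach S t w a × Interior S t q a)

-- the edge of T[S] with lower endpoint e is incident to the parent (in
-- T[S]) of the leaf labelled lam
IncParent : ∀ {n} → Subset n → (t : Tree (Fin n)) → Fin n → Pos t → Set
IncParent S t lam e = Kept S t e × Σ[ qλ ∈ Pos _ ] (subtree t qλ ≡ leaf lam ×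
  Σ[ x ∈ Vtx _ ] (ParentIn S t qλ x × (x ≡ pos e ⊎ ParentIn S t e x)))

ScarTypeIn : ∀ {n} → Tanglegram n → Subset n → Fin n → Fin n → Set
ScarTypeIn T X m₁ m₂ = Σ[ e ∈ Pos (L T) ] Σ[ f ∈ Pos (R T) ]
  ((ScarOn X (L T) m₂ e × IncParent X (L T) m₁ e) ×
   (ScarOn X (R T) m₂ f × IncParent X (R T) m₁ f))

{-# OPTIONS --safe #-}
module Submission where

-- Let the scar of m₂ lie on the edge of T[X] with lower end e, let a be the vertex of T⟦X⟧ where
-- the leaf of m₂ attaches, and let M be the restriction of the subtree at e to X − m₁. We find a
-- vertex v of T with m₁ and m₂ below it such that below v the restriction to X is M with the leaf m₁
-- grafted on top, while the restriction to X′ = (X − m₁) ∪ {m₂} is M with the leaf m₂ grafted on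
-- top. If e is the edge of m₁ or the edge above the parent of m₁ in T[X], take v = a. If e is the
-- edge of the sibling of m₁, take v = their common parent p: below p, X′ sees exactly what it sees
-- below a. Outside v the sets X and X′ agree, so relabelling m₂ as m₁ is an isomorphism.

open import Defs
open import Data.Nat using (ℕ)
open import Data.Fin using (Fin; zero; _≟_)
open import Data.Fin.Subset using (Subset; _∈_; _∉_; _-_; _─_; _∪_; ⁅_⁆)
open import Data.Fin.Subset.Properties using (_∈?_; x∈p∪q⁻; x∈p∪q⁺; p─q⊆p; x∈⁅x⁆; x∈⁅y⁆⇒x≡y; x∈p∧x≢y⇒x∈p-y)
open import Data.Bool using (true; false; if_then_else_)
open import Data.Bool.Properties using (¬-not)
open import Data.Vec using (lookup; _∷_; there)
open import Data.Vec.Properties using ([]=⇒lookup; lookup⇒[]=)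
open import Data.List using (List; []; _∷_; _++_; allFin)
open import Data.List.Relation.Unary.Any using (Any; here; there)
open import Data.List.Relation.Unary.Any.Properties using (++⁺ˡ)
open import Data.List.Relation.Unary.All as All using ()
open import Data.List.Relation.Unary.All.Properties using (++⁻)
open import Data.List.Relation.Unary.AllPairs using ([]; _∷_)
open import Data.List.Relation.Unary.Unique.Propositional using (Unique)
open import Data.List.Relation.Unary.Unique.Propositional.Properties using (allFin⁺)
open import Data.List.Relation.Binary.Disjoint.Propositional using (Disjoint)
open import Data.List.Relation.Binary.Subset.Propositional renaming (_⊆_ to _⊆ₗ_)
open import Data.List.Relation.Binary.Subset.Propositional.Properties using (Any-resp-⊆)
open import Data.List.Membership.Propositional using (lose) renaming (_∈_ to _∈ₗ_; _∉_ to _∉ₗ_)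
open import Data.List.Membership.Propositional.Properties using (∈-++⁺ˡ; ∈-++⁺ʳ; ∈-++⁻)
open import Data.List.Relation.Binary.Permutation.Propositional using (_↭_; ↭-sym; ↭⇒↭ₛ)
open import Data.List.Relation.Binary.Permutation.Setoid.Properties using (Unique-resp-↭)
open import Data.Maybe using (Maybe; just; nothing)
open import Data.Maybe.Relation.Binary.Pointwise using (Pointwise; just; nothing)
open import Data.Product using (_×_; _,_; proj₁; proj₂)
open import Data.Sum as Sum using (_⊎_; inj₁; inj₂)
open import Data.Empty using (⊥-elim)
open import Data.Unit using (⊤)
open import Function using (id; _∘_; _⇔_; mk⇔; Equivalence)
open import Relation.Nullary using (¬_; does; yes; no)
open import Relation.Binary.PropositionalEquality using (_≡_; _≢_; refl; sym; trans; cong; cong₂; subst; setoid)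
open import Relation.Binary.PropositionalEquality using (module ≡-Reasoning)

private
  variable
    A : Set
    a b m : A
    l r t : Tree A

-- Positions and leaves

⊑-refl : {v : Pos t} → v ⊑ v
⊑-refl {v = here}  = here⊑
⊑-refl {v = goL v} = goL⊑ ⊑-refl
⊑-refl {v = goR v} = goR⊑ ⊑-refl

⊑-trans : {u v w : Pos t} → u ⊑ v → v ⊑ w → u ⊑ w
⊑-trans here⊑     _        = here⊑
⊑-trans (goL⊑ p) (goL⊑ q) = goL⊑ (⊑-trans p q)
⊑-trans (goR⊑ p) (goR⊑ q) = goR⊑ (⊑-trans p q)

⊑-linear : {u v w : Pos t} → u ⊑ w → v ⊑ w → u ⊑ v ⊎ v ⊑ u
⊑-linear here⊑     _        = inj₁ here⊑
⊑-linear _         here⊑    = inj₂ here⊑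
⊑-linear (goL⊑ p) (goL⊑ q) = Sum.map goL⊑ goL⊑ (⊑-linear p q)
⊑-linear (goR⊑ p) (goR⊑ q) = Sum.map goR⊑ goR⊑ (⊑-linear p q)

⊏-goL : {u q : Pos l} → u ⊏ q → _⊏_ {t = node l r} (goL u) (goL q)
⊏-goL (u⊑q , u≢q) = goL⊑ u⊑q , λ { refl → u≢q refl }

⊏-goR : {u q : Pos r} → u ⊏ q → _⊏_ {t = node l r} (goR u) (goR q)
⊏-goR (u⊑q , u≢q) = goR⊑ u⊑q , λ { refl → u≢q refl }

here⊏goL : {q : Pos l} → _⊏_ {t = node l r} here (goL q)
here⊏goL = here⊑ , λ ()

here⊏goR : {q : Pos r} → _⊏_ {t = node l r} here (goR q)
here⊏goR = here⊑ , λ ()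

subtree-leaves⊆ : (q : Pos t) → leaves (subtree t q) ⊆ₗ leaves t
subtree-leaves⊆                here    = id
subtree-leaves⊆ {t = node l r} (goL q) = ∈-++⁺ˡ ∘ subtree-leaves⊆ q
subtree-leaves⊆ {t = node l r} (goR q) = ∈-++⁺ʳ (leaves l) ∘ subtree-leaves⊆ q

leaves-⊑ : {v q : Pos t} → v ⊑ q → leaves (subtree t q) ⊆ₗ leaves (subtree t v)
leaves-⊑ (here⊑ {q = q}) = subtree-leaves⊆ q
leaves-⊑ (goL⊑ p)        = leaves-⊑ p
leaves-⊑ (goR⊑ p)        = leaves-⊑ p

leaf-∈ : (q : Pos t) → subtree t q ≡ leaf b → b ∈ₗ leaves (subtree t q)
leaf-∈ q eq rewrite eq = here refl

∈-leaf : (q : Pos t) → subtree t q ≡ leaf b → a ∈ₗ leaves (subtree t q) → a ≡ b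
∈-leaf q eq i rewrite eq with i
... | here a≡b = a≡b

outside : (t : Tree A) → Pos t → List A
outside t          here    = []
outside (node l r) (goL q) = outside l q ++ leaves r
outside (node l r) (goR q) = leaves l ++ outside r q

-- offPath p lists the leaves below v hanging off the path from v down to q;
-- offPath⁺ p only those hanging off it strictly below v.
offPath : {t : Tree A} {v q : Pos t} → v ⊑ q → List A
offPath (here⊑ {q = q}) = outside _ q
offPath (goL⊑ p)        = offPath p
offPath (goR⊑ p)        = offPath p

offPath⁺ : {t : Tree A} {v q : Pos t} → v ⊑ q → List A
offPath⁺ (here⊑ {q = here})                 = []
offPath⁺ {t = node l r} (here⊑ {q = goL q}) = outside l q
offPath⁺ {t = node l r} (here⊑ {q = goR q}) = outside r q
offPath⁺ (goL⊑ p)                           = offPath⁺ p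
offPath⁺ (goR⊑ p)                           = offPath⁺ p

leaves-split : (q : Pos t) → b ∈ₗ leaves t → b ∈ₗ leaves (subtree t q) ⊎ b ∈ₗ outside t q
leaves-split here i = inj₁ i
leaves-split {t = node l r} (goL q) i with ∈-++⁻ (leaves l) i
... | inj₁ il = Sum.map₂ ∈-++⁺ˡ (leaves-split q il)
... | inj₂ ir = inj₂ (∈-++⁺ʳ (outside l q) ir)
leaves-split {t = node l r} (goR q) i with ∈-++⁻ (leaves l) i
... | inj₁ il = inj₂ (∈-++⁺ˡ il)
... | inj₂ ir = Sum.map₂ (∈-++⁺ʳ (leaves l)) (leaves-split q ir)

outside⊆leaves : (q : Pos t) → outside t q ⊆ₗ leaves t
outside⊆leaves here ()
outside⊆leaves {t = node l r} (goL q) i with ∈-++⁻ (outside l q) i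
... | inj₁ io = ∈-++⁺ˡ (outside⊆leaves q io)
... | inj₂ ir = ∈-++⁺ʳ (leaves l) ir
outside⊆leaves {t = node l r} (goR q) i with ∈-++⁻ (leaves l) i
... | inj₁ il = ∈-++⁺ˡ il
... | inj₂ io = ∈-++⁺ʳ (leaves l) (outside⊆leaves q io)

offPath⊆ : {v q : Pos t} (p : v ⊑ q) → offPath p ⊆ₗ leaves (subtree t v)
offPath⊆ (here⊑ {q = q}) = outside⊆leaves q
offPath⊆ (goL⊑ p)        = offPath⊆ p
offPath⊆ (goR⊑ p)        = offPath⊆ p

UniqueLeaves : Tree A → Set
UniqueLeaves (leaf _)   = ⊤
UniqueLeaves (node l r) = UniqueLeaves l × UniqueLeaves r × Disjoint (leaves l) (leaves r)

Unique-++⁻ : (xs : List A) {ys : List A} → Unique (xs ++ ys) → Unique xs × Unique ys × Disjoint xs ys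
Unique-++⁻ []       u        = [] , u , λ ()
Unique-++⁻ (x ∷ xs) (x∉ ∷ u) with Unique-++⁻ xs u
... | uxs , uys , disjoint = proj₁ (++⁻ xs x∉) ∷ uxs , uys , disjoint′
  where
  disjoint′ : Disjoint (x ∷ xs) _
  disjoint′ (here refl , j) = All.lookup (proj₂ (++⁻ xs x∉)) j refl
  disjoint′ (there i   , j) = disjoint (i , j)

Unique⇒UniqueLeaves : (t : Tree A) → Unique (leaves t) → UniqueLeaves t
Unique⇒UniqueLeaves (leaf _)   _ = _
Unique⇒UniqueLeaves (node l r) u with Unique-++⁻ (leaves l) u
... | ul , ur , disjoint = Unique⇒UniqueLeaves l ul , Unique⇒UniqueLeaves r ur , disjoint

outside-disjoint : UniqueLeaves t → (q : Pos t) → b ∈ₗ leaves (subtree t q) → b ∉ₗ outside t q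
outside-disjoint _ here _ ()
outside-disjoint {t = node l r} (ul , _ , disjoint) (goL q) i j with ∈-++⁻ (outside l q) j
... | inj₁ jo = outside-disjoint ul q i jo
... | inj₂ jr = disjoint (subtree-leaves⊆ q i , jr)
outside-disjoint {t = node l r} (_ , ur , disjoint) (goR q) i j with ∈-++⁻ (leaves l) j
... | inj₁ jl = disjoint (jl , subtree-leaves⊆ q i)
... | inj₂ jo = outside-disjoint ur q i jo

offPath-disjoint : UniqueLeaves t → {v q : Pos t} (p : v ⊑ q) →
                   b ∈ₗ leaves (subtree t q) → b ∉ₗ offPath p
offPath-disjoint u (here⊑ {q = q}) = outside-disjoint u q
offPath-disjoint u (goL⊑ p)        = offPath-disjoint (proj₁ u) p
offPath-disjoint u (goR⊑ p)        = offPath-disjoint (proj₁ (proj₂ u)) p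

leaf-position : UniqueLeaves t → {v q : Pos t} → subtree t q ≡ leaf b → b ∈ₗ leaves (subtree t v) → v ⊑ q
leaf-position _ {here}          _  _ = here⊑
leaf-position _ {goL v} {here}  () _
leaf-position _ {goR v} {here}  () _
leaf-position u {goL v} {goL q} eq i = goL⊑ (leaf-position (proj₁ u) eq i)
leaf-position u {goR v} {goR q} eq i = goR⊑ (leaf-position (proj₁ (proj₂ u)) eq i)
leaf-position u {goL v} {goR q} eq i =
  ⊥-elim (proj₂ (proj₂ u) (subtree-leaves⊆ v i , subtree-leaves⊆ q (leaf-∈ q eq)))
leaf-position u {goR v} {goL q} eq i =
  ⊥-elim (proj₂ (proj₂ u) (subtree-leaves⊆ q (leaf-∈ q eq) , subtree-leaves⊆ v i))

-- Restriction

private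
  variable
    n : ℕ
    S S′ : Subset n

join : Maybe (Tree A) → Maybe (Tree A) → Maybe (Tree A)
join (just l) (just r) = just (node l r)
join (just l) nothing  = just l
join nothing  r        = r

join-nothingʳ : (L : Maybe (Tree A)) → join L nothing ≡ L
join-nothingʳ (just _) = refl
join-nothingʳ nothing  = refl

restrict-node : (S : Subset n) (l r : Tree (Fin n)) → restrict S (node l r) ≡ join (restrict S l) (restrict S r)
restrict-node S l r with restrict S l | restrict S r
... | just _  | just _  = refl
... | just _  | nothing = refl
... | nothing | just _  = refl
... | nothing | nothing = refl

restrict-leaf : {x : Fin n} → x ∈ S → restrict S (leaf x) ≡ just (leaf x)
restrict-leaf x∈S rewrite []=⇒lookup x∈S = refl

lookup-∉ : {x : Fin n} → x ∉ S → lookup S x ≡ false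
lookup-∉ {S = S} {x} x∉S = ¬-not (x∉S ∘ lookup⇒[]= x S)

lookup-cong : {x : Fin n} → x ∈ S ⇔ x ∈ S′ → lookup S x ≡ lookup S′ x
lookup-cong {S = S} {x = x} x∈S⇔x∈S′ with x ∈? S
... | yes x∈S = trans ([]=⇒lookup x∈S) (sym ([]=⇒lookup (Equivalence.to x∈S⇔x∈S′ x∈S)))
... | no  x∉S = trans (lookup-∉ x∉S) (sym (lookup-∉ (x∉S ∘ Equivalence.from x∈S⇔x∈S′)))

restrict-∅ : (t : Tree (Fin n)) → (∀ {b} → b ∈ₗ leaves t → b ∉ S) → restrict S t ≡ nothing
restrict-∅ (leaf x) ∉S rewrite lookup-∉ (∉S (here refl)) = refl
restrict-∅ {S = S} (node l r) ∉S = trans (restrict-node S l r)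
  (cong₂ join (restrict-∅ l (∉S ∘ ∈-++⁺ˡ)) (restrict-∅ r (∉S ∘ ∈-++⁺ʳ (leaves l))))

restrict-cong : (t : Tree (Fin n)) → (∀ {b} → b ∈ₗ leaves t → b ∈ S ⇔ b ∈ S′) → restrict S t ≡ restrict S′ t
restrict-cong (leaf x) agree rewrite lookup-cong (agree (here refl)) = refl
restrict-cong {S = S} {S′} (node l r) agree = begin
  restrict S (node l r)                ≡⟨ restrict-node S l r ⟩
  join (restrict S l) (restrict S r)   ≡⟨ cong₂ join (restrict-cong l (agree ∘ ∈-++⁺ˡ))
                                                     (restrict-cong r (agree ∘ ∈-++⁺ʳ (leaves l))) ⟩
  join (restrict S′ l) (restrict S′ r) ≡⟨ restrict-node S′ l r ⟨
  restrict S′ (node l r)               ∎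
  where open ≡-Reasoning

restrict-outside : (q : Pos t) → (∀ {b} → b ∈ₗ outside t q → b ∉ S) → restrict S t ≡ restrict S (subtree t q)
restrict-outside here _ = refl
restrict-outside {t = node l r} {S = S} (goL q) ∉S = begin
  restrict S (node l r)              ≡⟨ restrict-node S l r ⟩
  join (restrict S l) (restrict S r) ≡⟨ cong (join _) (restrict-∅ r (∉S ∘ ∈-++⁺ʳ (outside l q))) ⟩
  join (restrict S l) nothing        ≡⟨ join-nothingʳ _ ⟩
  restrict S l                       ≡⟨ restrict-outside q (∉S ∘ ∈-++⁺ˡ) ⟩
  restrict S (subtree l q)           ∎
  where open ≡-Reasoning
restrict-outside {t = node l r} {S = S} (goR q) ∉S = begin
  restrict S (node l r)              ≡⟨ restrict-node S l r ⟩
  join (restrict S l) (restrict S r) ≡⟨ cong (λ L → join L _) (restrict-∅ l (∉S ∘ ∈-++⁺ˡ)) ⟩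
  restrict S r                       ≡⟨ restrict-outside q (∉S ∘ ∈-++⁺ʳ (leaves l)) ⟩
  restrict S (subtree r q)           ∎
  where open ≡-Reasoning

restrict-offPath : {v q : Pos t} (p : v ⊑ q) → (∀ {b} → b ∈ₗ offPath p → b ∉ S) →
                   restrict S (subtree t v) ≡ restrict S (subtree t q)
restrict-offPath (here⊑ {q = q}) = restrict-outside q
restrict-offPath (goL⊑ p)        = restrict-offPath p
restrict-offPath (goR⊑ p)        = restrict-offPath p

restrict-to-leaf : (q : Pos t) → subtree t q ≡ leaf m → m ∈ S → (∀ {b} → b ∈ₗ outside t q → b ∉ S) →
                   restrict S t ≡ just (leaf m)
restrict-to-leaf {S = S} q eq m∈S ∉S =
  trans (restrict-outside q ∉S) (trans (cong (restrict S) eq) (restrict-leaf m∈S))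

-- Vertices of T[S] along a path

NoKeptAbove : Subset n → (t : Tree (Fin n)) → Pos t → Set
NoKeptAbove S t q = ∀ u → u ⊏ q → ¬ Kept S t u

NoKeptFrom : Subset n → (t : Tree (Fin n)) → Pos t → Pos t → Set
NoKeptFrom S t v q = ∀ u → v ⊑ u → u ⊏ q → ¬ Kept S t u

NoKeptBetween : Subset n → (t : Tree (Fin n)) → Pos t → Pos t → Set
NoKeptBetween S t v q = ∀ u → v ⊏ u → u ⊏ q → ¬ Kept S t u

module _ {l r : Tree (Fin n)} where

  Kept-goL⁺ : {u : Pos l} → Kept S l u → Kept S (node l r) (goL u)
  Kept-goL⁺ (keptLeaf eq x∈S)     = keptLeaf eq x∈S
  Kept-goL⁺ (keptNode eq inl inr) = keptNode eq inl inr

  Kept-goL⁻ : {u : Pos l} → Kept S (node l r) (goL u) → Kept S l u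
  Kept-goL⁻ (keptLeaf eq x∈S)     = keptLeaf eq x∈S
  Kept-goL⁻ (keptNode eq inl inr) = keptNode eq inl inr

  Kept-goR⁺ : {u : Pos r} → Kept S r u → Kept S (node l r) (goR u)
  Kept-goR⁺ (keptLeaf eq x∈S)     = keptLeaf eq x∈S
  Kept-goR⁺ (keptNode eq inl inr) = keptNode eq inl inr

  Kept-goR⁻ : {u : Pos r} → Kept S (node l r) (goR u) → Kept S r u
  Kept-goR⁻ (keptLeaf eq x∈S)     = keptLeaf eq x∈S
  Kept-goR⁻ (keptNode eq inl inr) = keptNode eq inl inr

  NoKeptAbove-goL : {q : Pos l} → NoKeptAbove S (node l r) (goL q) → NoKeptAbove S l q
  NoKeptAbove-goL free u u⊏q = free (goL u) (⊏-goL u⊏q) ∘ Kept-goL⁺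

  NoKeptAbove-goR : {q : Pos r} → NoKeptAbove S (node l r) (goR q) → NoKeptAbove S r q
  NoKeptAbove-goR free u u⊏q = free (goR u) (⊏-goR u⊏q) ∘ Kept-goR⁺

  NoKeptFrom-goL : {v q : Pos l} → NoKeptFrom S (node l r) (goL v) (goL q) → NoKeptFrom S l v q
  NoKeptFrom-goL free u v⊑u u⊏q = free (goL u) (goL⊑ v⊑u) (⊏-goL u⊏q) ∘ Kept-goL⁺

  NoKeptFrom-goR : {v q : Pos r} → NoKeptFrom S (node l r) (goR v) (goR q) → NoKeptFrom S r v q
  NoKeptFrom-goR free u v⊑u u⊏q = free (goR u) (goR⊑ v⊑u) (⊏-goR u⊏q) ∘ Kept-goR⁺

  NoKeptBetween-goL : {v q : Pos l} → NoKeptBetween S (node l r) (goL v) (goL q) → NoKeptBetween S l v q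
  NoKeptBetween-goL free u v⊏u u⊏q = free (goL u) (⊏-goL v⊏u) (⊏-goL u⊏q) ∘ Kept-goL⁺

  NoKeptBetween-goR : {v q : Pos r} → NoKeptBetween S (node l r) (goR v) (goR q) → NoKeptBetween S r v q
  NoKeptBetween-goR free u v⊏u u⊏q = free (goR u) (⊏-goR v⊏u) (⊏-goR u⊏q) ∘ Kept-goR⁺

  NoKeptBetween-here-goL : {q : Pos l} → NoKeptBetween S (node l r) here (goL q) → NoKeptAbove S l q
  NoKeptBetween-here-goL free u u⊏q = free (goL u) here⊏goL (⊏-goL u⊏q) ∘ Kept-goL⁺

  NoKeptBetween-here-goR : {q : Pos r} → NoKeptBetween S (node l r) here (goR q) → NoKeptAbove S r q
  NoKeptBetween-here-goR free u u⊏q = free (goR u) here⊏goR (⊏-goR u⊏q) ∘ Kept-goR⁺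

InPaths⇒Any : (q : Pos t) → InPaths S t q → Any (_∈ S) (leaves t)
InPaths⇒Any q = Any-resp-⊆ (subtree-leaves⊆ q)

Kept⇒InPaths : {v : Pos t} → Kept S t v → InPaths S t v
Kept⇒InPaths (keptLeaf eq x∈S)   rewrite eq = here x∈S
Kept⇒InPaths (keptNode eq inl _) rewrite eq = ++⁺ˡ inl

outside-∉ : (q : Pos t) → InPaths S t q → NoKeptAbove S t q → ∀ {b} → b ∈ₗ outside t q → b ∉ S
outside-∉ here _ _ ()
outside-∉ {t = node l r} (goL q) inq free i b∈S with ∈-++⁻ (outside l q) i
... | inj₁ io = outside-∉ q inq (NoKeptAbove-goL free) io b∈S
... | inj₂ ir = free here here⊏goL (keptNode refl (InPaths⇒Any q inq) (lose ir b∈S))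
outside-∉ {t = node l r} (goR q) inq free i b∈S with ∈-++⁻ (leaves l) i
... | inj₁ il = free here here⊏goR (keptNode refl (lose il b∈S) (InPaths⇒Any q inq))
... | inj₂ io = outside-∉ q inq (NoKeptAbove-goR free) io b∈S

offPath-∉ : {v q : Pos t} (p : v ⊑ q) → InPaths S t q → NoKeptFrom S t v q →
            ∀ {b} → b ∈ₗ offPath p → b ∉ S
offPath-∉ (here⊑ {q = q}) inq free = outside-∉ q inq (λ u → free u here⊑)
offPath-∉ (goL⊑ p)        inq free = offPath-∉ p inq (NoKeptFrom-goL free)
offPath-∉ (goR⊑ p)        inq free = offPath-∉ p inq (NoKeptFrom-goR free)

offPath⁺-∉ : {v q : Pos t} (p : v ⊑ q) → InPaths S t q → NoKeptBetween S t v q →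
             ∀ {b} → b ∈ₗ offPath⁺ p → b ∉ S
offPath⁺-∉ (here⊑ {q = here})  _   _    ()
offPath⁺-∉ (here⊑ {q = goL q}) inq free = outside-∉ q inq (NoKeptBetween-here-goL free)
offPath⁺-∉ (here⊑ {q = goR q}) inq free = outside-∉ q inq (NoKeptBetween-here-goR free)
offPath⁺-∉ (goL⊑ p)            inq free = offPath⁺-∉ p inq (NoKeptBetween-goL free)
offPath⁺-∉ (goR⊑ p)            inq free = offPath⁺-∉ p inq (NoKeptBetween-goR free)

S-leaves-below : (q : Pos t) → InPaths S t q → NoKeptAbove S t q →
                 b ∈ₗ leaves t → b ∈ S → b ∈ₗ leaves (subtree t q)
S-leaves-below q inq free i b∈S with leaves-split q i
... | inj₁ iq = iq
... | inj₂ io = ⊥-elim (outside-∉ q inq free io b∈S)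

topmost-kept-unique : {q₁ q₂ : Pos t} → Kept S t q₁ → Kept S t q₂ →
                      NoKeptAbove S t q₁ → NoKeptAbove S t q₂ → q₁ ≡ q₂
topmost-kept-unique {q₁ = here}   {here}   _  _  _  _  = refl
topmost-kept-unique {q₁ = here}   {goL _}  k₁ _  _  f₂ = ⊥-elim (f₂ here here⊏goL k₁)
topmost-kept-unique {q₁ = here}   {goR _}  k₁ _  _  f₂ = ⊥-elim (f₂ here here⊏goR k₁)
topmost-kept-unique {q₁ = goL _}  {here}   _  k₂ f₁ _  = ⊥-elim (f₁ here here⊏goL k₂)
topmost-kept-unique {q₁ = goR _}  {here}   _  k₂ f₁ _  = ⊥-elim (f₁ here here⊏goR k₂)
topmost-kept-unique {q₁ = goL _}  {goL _}  k₁ k₂ f₁ f₂ = cong goL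
  (topmost-kept-unique (Kept-goL⁻ k₁) (Kept-goL⁻ k₂) (NoKeptAbove-goL f₁) (NoKeptAbove-goL f₂))
topmost-kept-unique {q₁ = goR _}  {goR _}  k₁ k₂ f₁ f₂ = cong goR
  (topmost-kept-unique (Kept-goR⁻ k₁) (Kept-goR⁻ k₂) (NoKeptAbove-goR f₁) (NoKeptAbove-goR f₂))
topmost-kept-unique {q₁ = goL q₁} {goR q₂} k₁ k₂ f₁ _  = ⊥-elim (f₁ here here⊏goL
  (keptNode refl (InPaths⇒Any q₁ (Kept⇒InPaths k₁)) (InPaths⇒Any q₂ (Kept⇒InPaths k₂))))
topmost-kept-unique {q₁ = goR q₁} {goL q₂} k₁ k₂ _  f₂ = ⊥-elim (f₂ here here⊏goL
  (keptNode refl (InPaths⇒Any q₂ (Kept⇒InPaths k₂)) (InPaths⇒Any q₁ (Kept⇒InPaths k₁))))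

common-parent : {p q₁ q₂ : Pos t} → Kept S t q₁ → Kept S t q₂ → p ⊏ q₁ → p ⊏ q₂ →
                NoKeptBetween S t p q₁ → NoKeptBetween S t p q₂ →
                q₁ ≡ q₂ ⊎ (∀ {b} → b ∈ₗ leaves (subtree t p) → b ∈ S →
                           b ∈ₗ leaves (subtree t q₁) ⊎ b ∈ₗ leaves (subtree t q₂))
common-parent _ _ (here⊑ {q = here} , p≢q₁) _ _ _ = ⊥-elim (p≢q₁ refl)
common-parent _ _ _ (here⊑ {q = here} , p≢q₂) _ _ = ⊥-elim (p≢q₂ refl)
common-parent k₁ k₂ (here⊑ {q = goL _} , _) (here⊑ {q = goL _} , _) f₁ f₂ = inj₁ (cong goL
  (topmost-kept-unique (Kept-goL⁻ k₁) (Kept-goL⁻ k₂) (NoKeptBetween-here-goL f₁) (NoKeptBetween-here-goL f₂)))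
common-parent k₁ k₂ (here⊑ {q = goR _} , _) (here⊑ {q = goR _} , _) f₁ f₂ = inj₁ (cong goR
  (topmost-kept-unique (Kept-goR⁻ k₁) (Kept-goR⁻ k₂) (NoKeptBetween-here-goR f₁) (NoKeptBetween-here-goR f₂)))
common-parent {t = node l r} k₁ k₂ (here⊑ {q = goL q₁} , _) (here⊑ {q = goR q₂} , _) f₁ f₂ = inj₂ λ i b∈S →
  Sum.map (λ il → S-leaves-below q₁ (Kept⇒InPaths k₁) (NoKeptBetween-here-goL f₁) il b∈S)
          (λ ir → S-leaves-below q₂ (Kept⇒InPaths k₂) (NoKeptBetween-here-goR f₂) ir b∈S)
          (∈-++⁻ (leaves l) i)
common-parent {t = node l r} k₁ k₂ (here⊑ {q = goR q₁} , _) (here⊑ {q = goL q₂} , _) f₁ f₂ = inj₂ λ i b∈S →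
  Sum.swap (Sum.map (λ il → S-leaves-below q₂ (Kept⇒InPaths k₂) (NoKeptBetween-here-goL f₂) il b∈S)
                    (λ ir → S-leaves-below q₁ (Kept⇒InPaths k₁) (NoKeptBetween-here-goR f₁) ir b∈S)
                    (∈-++⁻ (leaves l) i))
common-parent k₁ k₂ (goL⊑ p₁ , p≢q₁) (goL⊑ p₂ , p≢q₂) f₁ f₂ = Sum.map₁ (cong goL)
  (common-parent (Kept-goL⁻ k₁) (Kept-goL⁻ k₂) (p₁ , p≢q₁ ∘ cong goL) (p₂ , p≢q₂ ∘ cong goL)
                 (NoKeptBetween-goL f₁) (NoKeptBetween-goL f₂))
common-parent k₁ k₂ (goR⊑ p₁ , p≢q₁) (goR⊑ p₂ , p≢q₂) f₁ f₂ = Sum.map₁ (cong goR)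
  (common-parent (Kept-goR⁻ k₁) (Kept-goR⁻ k₂) (p₁ , p≢q₁ ∘ cong goR) (p₂ , p≢q₂ ∘ cong goR)
                 (NoKeptBetween-goR f₁) (NoKeptBetween-goR f₂))

-- Grafting a leaf on top of a restriction

x∈p─q⇒x∉q : {x : Fin n} (p q : Subset n) → x ∈ p ─ q → x ∉ q
x∈p─q⇒x∉q {x = zero} (_ ∷ _) (true  ∷ _) () _
x∈p─q⇒x∉q {x = zero} (_ ∷ _) (false ∷ _) _  ()
x∈p─q⇒x∉q (_ ∷ p) (_ ∷ q) (there i) (there j) = x∈p─q⇒x∉q p q i j

∈-minus⁻ : (S : Subset n) {x y : Fin n} → x ∈ S - y → x ∈ S × x ≢ y
∈-minus⁻ S {y = y} x∈S-y = p─q⊆p S ⁅ y ⁆ x∈S-y , λ { refl → x∈p─q⇒x∉q S ⁅ y ⁆ x∈S-y (x∈⁅x⁆ y) }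

∈-minus⇔ : (S : Subset n) {x y : Fin n} → x ≢ y → x ∈ S - y ⇔ x ∈ S
∈-minus⇔ S {y = y} x≢y = mk⇔ (p─q⊆p S ⁅ y ⁆) (λ x∈S → x∈p∧x≢y⇒x∈p-y x∈S x≢y)

∉-minus-sole : (q : Pos t) → subtree t q ≡ leaf m → (∀ {b} → b ∈ₗ outside t q → b ∉ S) →
               ∀ {b} → b ∈ₗ leaves t → b ∉ S - m
∉-minus-sole {S = S} q eq ∉S i b∈S-m with ∈-minus⁻ S b∈S-m | leaves-split q i
... | _   , b≢m | inj₁ iq = b≢m (∈-leaf q eq iq)
... | b∈S , _   | inj₂ io = ∉S io b∈S

Grafted : A → Maybe (Tree A) → Maybe (Tree A) → Set
Grafted m M N = N ≡ join (just (leaf m)) M ⊎ N ≡ join M (just (leaf m))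

grafted-leaf : {s : Tree (Fin n)} {m : Fin n} → s ≡ leaf m → m ∈ S → Grafted m (restrict (S - m) s) (restrict S s)
grafted-leaf {S = S} {m = m} refl m∈S =
  inj₁ (trans (restrict-leaf m∈S) (cong (join (just (leaf m))) (sym m-removed)))
  where
  m-removed : restrict (S - m) (leaf m) ≡ nothing
  m-removed = restrict-∅ (leaf m) λ { (here refl) m∈S-m → proj₂ (∈-minus⁻ S m∈S-m) refl }

grafted-at-parent : UniqueLeaves t → {p q : Pos t} {m : Fin n} → subtree t q ≡ leaf m → m ∈ S →
                    (p⊑q : p ⊑ q) → (∀ {b} → b ∈ₗ offPath⁺ p⊑q → b ∉ S) →
                    Grafted m (restrict (S - m) (subtree t p)) (restrict S (subtree t p))
grafted-at-parent u eq m∈S (goL⊑ p⊑q) ∉S = grafted-at-parent (proj₁ u) eq m∈S p⊑q ∉S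
grafted-at-parent u eq m∈S (goR⊑ p⊑q) ∉S = grafted-at-parent (proj₁ (proj₂ u)) eq m∈S p⊑q ∉S
grafted-at-parent _ eq m∈S (here⊑ {q = here}) _ = grafted-leaf eq m∈S
grafted-at-parent {t = node l r} {S = S} (_ , _ , disjoint) {m = m} eq m∈S (here⊑ {q = goL q}) ∉S =
  inj₁ (trans (restrict-node S l r) (cong₂ join (restrict-to-leaf q eq m∈S ∉S) (sym rest)))
  where
  rest : restrict (S - m) (node l r) ≡ restrict S r
  rest = trans (restrict-node (S - m) l r) (cong₂ join
    (restrict-∅ l (∉-minus-sole q eq ∉S))
    (restrict-cong r λ i → ∈-minus⇔ S λ { refl → disjoint (subtree-leaves⊆ q (leaf-∈ q eq) , i) }))
grafted-at-parent {t = node l r} {S = S} (_ , _ , disjoint) {m = m} eq m∈S (here⊑ {q = goR q}) ∉S =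
  inj₂ (trans (restrict-node S l r) (cong₂ join (sym rest) (restrict-to-leaf q eq m∈S ∉S)))
  where
  rest : restrict (S - m) (node l r) ≡ restrict S l
  rest = trans (restrict-node (S - m) l r) (trans (cong₂ join
    (restrict-cong l λ i → ∈-minus⇔ S λ { refl → disjoint (i , subtree-leaves⊆ q (leaf-∈ q eq)) })
    (restrict-∅ r (∉-minus-sole q eq ∉S)))
    (join-nothingʳ _))

grafted-at-scar : UniqueLeaves t → {a w e : Pos t} {m : Fin n} → subtree t w ≡ leaf m → m ∈ S′ →
                  (∀ {b} → b ∈ S′ → b ∈ S ⊎ b ≡ m) →
                  a ⊑ w → (∀ u → a ⊏ u → u ⊑ w → ¬ InPaths S t u) →
                  (a⊏e : a ⊏ e) → InPaths S t e → (∀ {b} → b ∈ₗ offPath (proj₁ a⊏e) → b ∉ S) →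
                  Grafted m (restrict S′ (subtree t e)) (restrict S′ (subtree t a))
grafted-at-scar u eq m∈S′ S′⊆ (goL⊑ a⊑w) above (goL⊑ a⊑e , a≢e) ine ∉S =
  grafted-at-scar (proj₁ u) eq m∈S′ S′⊆ a⊑w (λ x a⊏x x⊑w → above (goL x) (⊏-goL a⊏x) (goL⊑ x⊑w))
                  (a⊑e , a≢e ∘ cong goL) ine ∉S
grafted-at-scar u eq m∈S′ S′⊆ (goR⊑ a⊑w) above (goR⊑ a⊑e , a≢e) ine ∉S =
  grafted-at-scar (proj₁ (proj₂ u)) eq m∈S′ S′⊆ a⊑w (λ x a⊏x x⊑w → above (goR x) (⊏-goR a⊏x) (goR⊑ x⊑w))
                  (a⊑e , a≢e ∘ cong goR) ine ∉S
grafted-at-scar _ _ _ _ here⊑ _ (here⊑ {q = here} , a≢e) _ _ = ⊥-elim (a≢e refl)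
grafted-at-scar _ _ _ _ (here⊑ {q = goL _}) above (here⊑ {q = goL e} , _) ine _ =
  ⊥-elim (above (goL here) here⊏goL (goL⊑ here⊑) (InPaths⇒Any e ine))
grafted-at-scar _ _ _ _ (here⊑ {q = goR _}) above (here⊑ {q = goR e} , _) ine _ =
  ⊥-elim (above (goR here) here⊏goR (goR⊑ here⊑) (InPaths⇒Any e ine))
grafted-at-scar {t = node l r} {S′ = S′} (ul , _ , disjoint) eq m∈S′ S′⊆
                (here⊑ {q = goL w}) _ (here⊑ {q = goR e} , _) _ ∉S =
  inj₁ (trans (restrict-node S′ l r) (cong₂ join (restrict-to-leaf w eq m∈S′ ∉S′ˡ) (restrict-outside e ∉S′ʳ)))
  where
  ∉S′ˡ : ∀ {b} → b ∈ₗ outside l w → b ∉ S′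
  ∉S′ˡ i = Sum.[ ∉S (∈-++⁺ˡ (outside⊆leaves w i)) , (λ { refl → outside-disjoint ul w (leaf-∈ w eq) i }) ] ∘ S′⊆
  ∉S′ʳ : ∀ {b} → b ∈ₗ outside r e → b ∉ S′
  ∉S′ʳ i = Sum.[ ∉S (∈-++⁺ʳ (leaves l) i)
               , (λ { refl → disjoint (subtree-leaves⊆ w (leaf-∈ w eq) , outside⊆leaves e i) }) ] ∘ S′⊆
grafted-at-scar {t = node l r} {S′ = S′} (_ , ur , disjoint) eq m∈S′ S′⊆
                (here⊑ {q = goR w}) _ (here⊑ {q = goL e} , _) _ ∉S =
  inj₂ (trans (restrict-node S′ l r) (cong₂ join (restrict-outside e ∉S′ˡ) (restrict-to-leaf w eq m∈S′ ∉S′ʳ)))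
  where
  ∉S′ˡ : ∀ {b} → b ∈ₗ outside l e → b ∉ S′
  ∉S′ˡ i = Sum.[ ∉S (∈-++⁺ˡ i)
               , (λ { refl → disjoint (outside⊆leaves e i , subtree-leaves⊆ w (leaf-∈ w eq)) }) ] ∘ S′⊆
  ∉S′ʳ : ∀ {b} → b ∈ₗ outside r w → b ∉ S′
  ∉S′ʳ i = Sum.[ ∉S (∈-++⁺ʳ (outside l e) (outside⊆leaves w i))
               , (λ { refl → outside-disjoint ur w (leaf-∈ w eq) i }) ] ∘ S′⊆

module _ {φ : A → A} where

  leaf-iso : φ a ≡ b → Iso φ (leaf a) (leaf b)
  leaf-iso {a = a} φa≡b = subst (λ z → Iso φ (leaf a) (leaf z)) φa≡b (leaf a)

  join-iso : {L′ L R′ R : Maybe (Tree A)} → Pointwise (Iso φ) L′ L → Pointwise (Iso φ) R′ R →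
             Pointwise (Iso φ) (join L′ R′) (join L R)
  join-iso (just i) (just j) = just (straight i j)
  join-iso (just i) nothing  = just i
  join-iso nothing  j        = j

  join-isoˡ : {L′ L R′ R : Maybe (Tree A)} → MIso φ L′ L → Pointwise (Iso φ) R′ R →
              MIso φ (join L′ R′) (join L R)
  join-isoˡ (just i) (just j) = just (straight i j)
  join-isoˡ (just i) nothing  = just i

  join-isoʳ : {L′ L R′ R : Maybe (Tree A)} → Pointwise (Iso φ) L′ L → MIso φ R′ R →
              MIso φ (join L′ R′) (join L R)
  join-isoʳ (just i) (just j) = just (straight i j)
  join-isoʳ nothing  j        = j

  graft-iso : {M N′ N : Maybe (Tree A)} → φ a ≡ b → Pointwise (Iso φ) M M →
              Grafted a M N′ → Grafted b M N → MIso φ N′ N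
  graft-iso φa≡b nothing  (inj₁ refl) (inj₁ refl) = just (leaf-iso φa≡b)
  graft-iso φa≡b nothing  (inj₁ refl) (inj₂ refl) = just (leaf-iso φa≡b)
  graft-iso φa≡b nothing  (inj₂ refl) (inj₁ refl) = just (leaf-iso φa≡b)
  graft-iso φa≡b nothing  (inj₂ refl) (inj₂ refl) = just (leaf-iso φa≡b)
  graft-iso φa≡b (just i) (inj₁ refl) (inj₁ refl) = just (straight (leaf-iso φa≡b) i)
  graft-iso φa≡b (just i) (inj₁ refl) (inj₂ refl) = just (cross (leaf-iso φa≡b) i)
  graft-iso φa≡b (just i) (inj₂ refl) (inj₁ refl) = just (cross i (leaf-iso φa≡b))
  graft-iso φa≡b (just i) (inj₂ refl) (inj₂ refl) = just (straight i (leaf-iso φa≡b))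

module _ {φ : Fin n → Fin n} where

  restrict-self-iso : (t : Tree (Fin n)) → (∀ {b} → b ∈ₗ leaves t → b ∈ S → φ b ≡ b) →
                      Pointwise (Iso φ) (restrict S t) (restrict S t)
  restrict-self-iso {S = S} (leaf x) fixed with x ∈? S
  ... | yes x∈S rewrite []=⇒lookup x∈S = just (leaf-iso (fixed (here refl) x∈S))
  ... | no  x∉S rewrite lookup-∉ x∉S   = nothing
  restrict-self-iso {S = S} (node l r) fixed rewrite restrict-node S l r =
    join-iso (restrict-self-iso l (fixed ∘ ∈-++⁺ˡ)) (restrict-self-iso r (fixed ∘ ∈-++⁺ʳ (leaves l)))

  restrict-iso-lift : (v : Pos t) → (∀ {b} → b ∈ₗ outside t v → b ∈ S′ ⇔ b ∈ S) →
                      (∀ {b} → b ∈ₗ outside t v → b ∈ S → φ b ≡ b) →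
                      MIso φ (restrict S′ (subtree t v)) (restrict S (subtree t v)) →
                      MIso φ (restrict S′ t) (restrict S t)
  restrict-iso-lift here _ _ iso = iso
  restrict-iso-lift {t = node l r} {S′ = S′} {S = S} (goL v) agree fixed iso
    rewrite restrict-node S′ l r | restrict-node S l r | restrict-cong r (agree ∘ ∈-++⁺ʳ (outside l v)) =
    join-isoˡ (restrict-iso-lift v (agree ∘ ∈-++⁺ˡ) (fixed ∘ ∈-++⁺ˡ) iso)
              (restrict-self-iso r (fixed ∘ ∈-++⁺ʳ (outside l v)))
  restrict-iso-lift {t = node l r} {S′ = S′} {S = S} (goR v) agree fixed iso
    rewrite restrict-node S′ l r | restrict-node S l r | restrict-cong l (agree ∘ ∈-++⁺ˡ) =
    join-isoʳ (restrict-self-iso l (fixed ∘ ∈-++⁺ˡ))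
              (restrict-iso-lift v (agree ∘ ∈-++⁺ʳ (leaves l)) (fixed ∘ ∈-++⁺ʳ (leaves l)) iso)

-- Trading m₁ for m₂

module Swap {n : ℕ} (X : Subset n) (m₁ m₂ : Fin n) (m₁∈X : m₁ ∈ X) (m₂∉X : m₂ ∉ X) where

  X′ : Subset n
  X′ = (X - m₁) ∪ ⁅ m₂ ⁆

  φ : Fin n → Fin n
  φ b = if does (b ≟ m₂) then m₁ else b

  φ-m₂ : φ m₂ ≡ m₁
  φ-m₂ with m₂ ≟ m₂
  ... | yes _     = refl
  ... | no  m₂≢m₂ = ⊥-elim (m₂≢m₂ refl)

  φ-fixed : {b : Fin n} → b ≢ m₂ → φ b ≡ b
  φ-fixed {b} b≢m₂ with b ≟ m₂
  ... | yes b≡m₂ = ⊥-elim (b≢m₂ b≡m₂)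
  ... | no  _    = refl

  m₂∈X′ : m₂ ∈ X′
  m₂∈X′ = x∈p∪q⁺ (inj₂ (x∈⁅x⁆ m₂))

  X′⁻ : {b : Fin n} → b ∈ X′ → b ∈ X - m₁ ⊎ b ≡ m₂
  X′⁻ b∈X′ = Sum.map₂ (x∈⁅y⁆⇒x≡y m₂) (x∈p∪q⁻ (X - m₁) ⁅ m₂ ⁆ b∈X′)

  X′⊆X∪m₂ : {b : Fin n} → b ∈ X′ → b ∈ X ⊎ b ≡ m₂
  X′⊆X∪m₂ = Sum.map₁ (proj₁ ∘ ∈-minus⁻ X) ∘ X′⁻

  X′⇔X : {b : Fin n} → b ≢ m₁ → b ≢ m₂ → b ∈ X′ ⇔ b ∈ X
  X′⇔X b≢m₁ b≢m₂ = mk⇔ (Sum.[ proj₁ ∘ ∈-minus⁻ X , ⊥-elim ∘ b≢m₂ ] ∘ X′⁻)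
                       (x∈p∪q⁺ ∘ inj₁ ∘ Equivalence.from (∈-minus⇔ X b≢m₁))

  X-m₁⇔X′ : {b : Fin n} → b ≢ m₂ → b ∈ X - m₁ ⇔ b ∈ X′
  X-m₁⇔X′ b≢m₂ = mk⇔ (x∈p∪q⁺ ∘ inj₁) (Sum.[ id , ⊥-elim ∘ b≢m₂ ] ∘ X′⁻)

  m₁-in-paths : {t : Tree (Fin n)} (q : Pos t) → subtree t q ≡ leaf m₁ → InPaths X t q
  m₁-in-paths q q-leaf = Kept⇒InPaths {v = q} (keptLeaf q-leaf m₁∈X)

  swap-lift : {t : Tree (Fin n)} → UniqueLeaves t → (v : Pos t) →
              m₁ ∈ₗ leaves (subtree t v) → m₂ ∈ₗ leaves (subtree t v) →
              MIso φ (restrict X′ (subtree t v)) (restrict X (subtree t v)) →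
              MIso φ (restrict X′ t) (restrict X t)
  swap-lift u v m₁∈v m₂∈v = restrict-iso-lift v
    (λ i → X′⇔X (λ { refl → outside-disjoint u v m₁∈v i }) (λ { refl → outside-disjoint u v m₂∈v i }))
    (λ i _ → φ-fixed λ { refl → outside-disjoint u v m₂∈v i })

  swap-graft : (s : Tree (Fin n)) {N′ N : Maybe (Tree (Fin n))} → m₂ ∉ₗ leaves s →
               Grafted m₂ (restrict X′ s) N′ → Grafted m₁ (restrict (X - m₁) s) N → MIso φ N′ N
  swap-graft s m₂∉s g₂ g₁ = graft-iso φ-m₂ M-fixed (subst (λ M → Grafted m₂ M _) (sym X-m₁≡X′) g₂) g₁
    where
    M-fixed : Pointwise (Iso φ) (restrict (X - m₁) s) (restrict (X - m₁) s)
    M-fixed = restrict-self-iso s λ _ b∈X-m₁ → φ-fixed λ { refl → m₂∉X (proj₁ (∈-minus⁻ X b∈X-m₁)) }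
    X-m₁≡X′ : restrict (X - m₁) s ≡ restrict X′ s
    X-m₁≡X′ = restrict-cong s λ i → X-m₁⇔X′ λ { refl → m₂∉s i }

  -- The scar of m₂ is on the edge of T[X] with lower end e; the leaf w of m₂ first meets T⟦X⟧ at a.
  module Scar {t : Tree (Fin n)} (u : UniqueLeaves t) {a e w : Pos t}
              (Ke : Kept X t e) (w-leaf : subtree t w ≡ leaf m₂) (a⊑w : a ⊑ w)
              (above : ∀ x → a ⊏ x → x ⊑ w → ¬ InPaths X t x) (a⊏e : a ⊏ e) (free : NoKeptFrom X t a e) where

    m₂-graft : Grafted m₂ (restrict X′ (subtree t e)) (restrict X′ (subtree t a))
    m₂-graft = grafted-at-scar u w-leaf m₂∈X′ X′⊆X∪m₂ a⊑w above a⊏e (Kept⇒InPaths Ke)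
                               (offPath-∉ (proj₁ a⊏e) (Kept⇒InPaths Ke) free)

    m₂∉e : m₂ ∉ₗ leaves (subtree t e)
    m₂∉e i = above e a⊏e (leaf-position u w-leaf i) (Kept⇒InPaths Ke)

    m₂∈a : m₂ ∈ₗ leaves (subtree t a)
    m₂∈a = leaves-⊑ a⊑w (leaf-∈ w w-leaf)

    swap-at-attachment : (q : Pos t) → subtree t q ≡ leaf m₁ → e ⊑ q →
                         Grafted m₁ (restrict (X - m₁) (subtree t e)) (restrict X (subtree t e)) →
                         MIso φ (restrict X′ t) (restrict X t)
    swap-at-attachment q q-leaf e⊑q m₁-graft =
      swap-lift u a (leaves-⊑ (⊑-trans (proj₁ a⊏e) e⊑q) (leaf-∈ q q-leaf)) m₂∈a
        (swap-graft (subtree t e) m₂∉e m₂-graft (subst (Grafted m₁ _) (sym X-a≡e) m₁-graft))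
      where
      X-a≡e : restrict X (subtree t a) ≡ restrict X (subtree t e)
      X-a≡e = restrict-offPath (proj₁ a⊏e) (offPath-∉ (proj₁ a⊏e) (Kept⇒InPaths Ke) free)

    -- e is the sibling of the leaf q of m₁ in T[X], below their common parent p.
    swap-at-parent : (q : Pos t) → subtree t q ≡ leaf m₁ → {p : Pos t} → Kept X t p →
                     (p⊑q : p ⊑ q) → NoKeptBetween X t p q → p ⊏ e →
                     (∀ {b} → b ∈ₗ leaves (subtree t p) → b ∈ X →
                              b ∈ₗ leaves (subtree t q) ⊎ b ∈ₗ leaves (subtree t e)) →
                     MIso φ (restrict X′ t) (restrict X t)
    swap-at-parent q q-leaf {p} Kp p⊑q free₁ p⊏e below-p =
      swap-lift u p (leaves-⊑ p⊑q (leaf-∈ q q-leaf)) (leaves-⊑ p⊑a m₂∈a)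
        (swap-graft (subtree t e) m₂∉e (subst (Grafted m₂ _) (sym X′-p≡a) m₂-graft)
                                       (subst (λ M → Grafted m₁ M _) X-m₁-p≡e m₁-graft))
      where
      p⊑e : p ⊑ e
      p⊑e = proj₁ p⊏e

      m₁-graft : Grafted m₁ (restrict (X - m₁) (subtree t p)) (restrict X (subtree t p))
      m₁-graft = grafted-at-parent u q-leaf m₁∈X p⊑q (offPath⁺-∉ p⊑q (m₁-in-paths q q-leaf) free₁)

      p⊑a : p ⊑ a
      p⊑a with ⊑-linear p⊑e (proj₁ a⊏e)
      ... | inj₁ p⊑a = p⊑a
      ... | inj₂ a⊑p = ⊥-elim (free p a⊑p p⊏e Kp)

      X-m₁-below-e : ∀ {b} → b ∈ₗ leaves (subtree t p) → b ∈ X - m₁ → b ∈ₗ leaves (subtree t e)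
      X-m₁-below-e i b∈X-m₁ with ∈-minus⁻ X b∈X-m₁
      ... | b∈X , b≢m₁ = Sum.[ ⊥-elim ∘ b≢m₁ ∘ ∈-leaf q q-leaf , id ] (below-p i b∈X)

      X′-below-a : ∀ {b} → b ∈ₗ leaves (subtree t p) → b ∈ X′ → b ∈ₗ leaves (subtree t a)
      X′-below-a i = Sum.[ leaves-⊑ (proj₁ a⊏e) ∘ X-m₁-below-e i , (λ { refl → m₂∈a }) ] ∘ X′⁻

      X-m₁-p≡e : restrict (X - m₁) (subtree t p) ≡ restrict (X - m₁) (subtree t e)
      X-m₁-p≡e = restrict-offPath p⊑e λ i b∈ → offPath-disjoint u p⊑e (X-m₁-below-e (offPath⊆ p⊑e i) b∈) i

      X′-p≡a : restrict X′ (subtree t p) ≡ restrict X′ (subtree t a)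
      X′-p≡a = restrict-offPath p⊑a λ i b∈ → offPath-disjoint u p⊑a (X′-below-a (offPath⊆ p⊑a i) b∈) i

    -- The three edges of T[X] at the parent x of m₁: the one above x (x ≡ pos e), that of m₁ itself
    -- (e ≡ q) and that of its sibling.
    swap : (q : Pos t) → subtree t q ≡ leaf m₁ → (x : Vtx t) → ParentIn X t q x →
           x ≡ pos e ⊎ ParentIn X t e x → MIso φ (restrict X′ t) (restrict X t)
    swap q q-leaf _ (parentPos _ e⊏q free₁) (inj₁ refl) = swap-at-attachment q q-leaf (proj₁ e⊏q)
      (grafted-at-parent u q-leaf m₁∈X (proj₁ e⊏q) (offPath⁺-∉ (proj₁ e⊏q) (m₁-in-paths q q-leaf) free₁))
    swap q q-leaf root (parentRoot free₁) (inj₂ (parentRoot free₂))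
      with topmost-kept-unique (keptLeaf q-leaf m₁∈X) Ke free₁ free₂
    ... | refl = swap-at-attachment q q-leaf ⊑-refl (grafted-leaf q-leaf m₁∈X)
    swap q q-leaf (pos p) (parentPos Kp p⊏q free₁) (inj₂ (parentPos _ p⊏e free₂))
      with common-parent (keptLeaf q-leaf m₁∈X) Ke p⊏q p⊏e free₁ free₂
    ... | inj₁ refl    = swap-at-attachment q q-leaf ⊑-refl (grafted-leaf q-leaf m₁∈X)
    ... | inj₂ below-p = swap-at-parent q q-leaf Kp (proj₁ p⊏q) free₁ p⊏e below-p

  swap-iso : {t : Tree (Fin n)} {e : Pos t} → UniqueLeaves t → ScarOn X t m₂ e → IncParent X t m₁ e →
             MIso φ (restrict X′ t) (restrict X t)
  swap-iso u (Ke , _ , (_ , w-leaf , a⊑w , _ , above) , a⊏e , free) (_ , q , q-leaf , x , q-parent , e-incident) =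
    Scar.swap u Ke w-leaf a⊑w above a⊏e free q q-leaf x q-parent e-incident

uniqueLeaves : (t : Tree (Fin n)) → leaves t ↭ allFin n → UniqueLeaves t
uniqueLeaves {n} t t↭ = Unique⇒UniqueLeaves t (Unique-resp-↭ (setoid (Fin n)) (↭⇒↭ₛ (↭-sym t↭)) (allFin⁺ n))

lemma3 : ∀ {n : ℕ} (T : Tanglegram n) (X : Subset n) (m₁ m₂ : Fin n) →
           m₁ ∈ X → m₂ ∉ X → ScarTypeIn T X m₁ m₂ →
           IsoSub T ((X - m₁) ∪ ⁅ m₂ ⁆) X
lemma3 T X m₁ m₂ m₁∈X m₂∉X (_ , _ , (scarL , incL) , (scarR , incR)) =
  φ , swap-iso (uniqueLeaves (L T) (L-leaves T)) scarL incL , swap-iso (uniqueLeaves (R T) (R-leaves T)) scarR incR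
  where open Swap X m₁ m₂ m₁∈X m₂∉X
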